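{- Let $F$ be a graph. (i) Let $m\ge 1$ be an integer and assume that every edge of $F$ lies in a cycle of $F$ of length at most $m+1$. Then $rsat(n,F)=\Omega(n^{1+1/m})$, i.e. there is a constant $c>0$ such that for all sufficiently large $n$ for which $rsat(n,F)$ exists, $rsat(n,F)\ge c\,n^{1+1/m}$. (ii) Let $r\ge 1$ be an integer and assume that for every edge $e$ of $F$, the graph $F\setminus e$ has diameter at most $r$. Then $rsat(n,F)=\Omega(n^{1+1/r})$ in the same sense. (iii) If $F$ is connected, then there exists a constant $c=c_F$ such that $\liminf_{n\to\infty} \frac{rsat(n,F)}{n}\le c$ if and only if $F$ contains a cut edge.
   Context: All graphs are finite and simple. A graph $G$ is $F$-saturated if $G$ contains no copy of $F$, but adding any edge between two non-adjacent vertices of $G$ creates a copy of $F$. $rsat(n,F)$ denotes the smallest number of edges in a regular $n$-vertex $F$-saturated graph, defined only for those $n$ for which such a graph exists (the $\liminf$ in (iii) is taken over such $n$). For an edge $e$ of $F$, $F\setminus e$ is the graph with the same vertex set as $F$ and edge set $E(F)\setminus\{e\}$. A cut edge is an edge whose removal increases the number of connected components. -}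

module Defs where

open import Data.Nat using (ℕ; zero; suc; _+_; _*_; _^_; _≤_; _<_)
open import Data.Fin using (Fin; zero; suc; toℕ; fromℕ; inject₁; _≟_)
open import Data.Bool using (Bool; true; false; _∧_; _∨_; not; if_then_else_)
open import Data.Nat using (_<ᵇ_)
open import Data.Product using (Σ; ∃; ∃-syntax; _×_; _,_)
open import Relation.Binary.PropositionalEquality using (_≡_)
open import Relation.Nullary.Decidable using (⌊_⌋)
open import Relation.Nullary using (¬_)
open import Function.Definitions using (Injective)
open import Function.Bundles using (_⇔_)

Adj : ℕ → Set
Adj n = Fin n → Fin n → Bool

record Graph (n : ℕ) : Set where
  field
    adj    : Adj n
    sym    : ∀ i j → adj i j ≡ adj j i
    irrefl : ∀ i → adj i i ≡ false
open Graph public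

sumFin : (n : ℕ) → (Fin n → ℕ) → ℕ
sumFin zero    f = 0
sumFin (suc n) f = f zero + sumFin n (λ i → f (suc i))

countFin : (n : ℕ) → (Fin n → Bool) → ℕ
countFin n p = sumFin n (λ i → if p i then 1 else 0)

degree : {n : ℕ} → Graph n → Fin n → ℕ
degree {n} G i = countFin n (λ j → adj G i j)

edges : {n : ℕ} → Graph n → ℕ
edges {n} G = sumFin n (λ i → countFin n (λ j → adj G i j ∧ (toℕ i <ᵇ toℕ j)))

Regular : {n : ℕ} → Graph n → Set
Regular {n} G = ∃[ d ] (∀ i → degree G i ≡ d)

Copy : {k n : ℕ} → Graph k → Adj n → Set
Copy {k} {n} F A = Σ (Fin k → Fin n) λ φ →
  Injective _≡_ _≡_ φ × (∀ u v → adj F u v ≡ true → A (φ u) (φ v) ≡ true)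

_==_ : {n : ℕ} → Fin n → Fin n → Bool
i == j = ⌊ i ≟ j ⌋

addEdge : {n : ℕ} → Adj n → Fin n → Fin n → Adj n
addEdge A u v i j = A i j ∨ ((i == u ∧ j == v) ∨ (i == v ∧ j == u))

removeEdge : {n : ℕ} → Adj n → Fin n → Fin n → Adj n
removeEdge A u v i j = A i j ∧ not ((i == u ∧ j == v) ∨ (i == v ∧ j == u))

Saturated : {k n : ℕ} → Graph k → Graph n → Set
Saturated F G =
  ¬ Copy F (adj G) ×
  (∀ u v → ¬ (u ≡ v) → adj G u v ≡ false → Copy F (addEdge (adj G) u v))

-- IsRsat F n e : "rsat(n,F) exists and equals e".
IsRsat : {k : ℕ} → Graph k → (n : ℕ) → ℕ → Set
IsRsat F n e =
  (Σ (Graph n) λ G → Regular G × Saturated F G × edges G ≡ e) ×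
  (∀ (G : Graph n) → Regular G → Saturated F G → e ≤ edges G)

Walk : {n : ℕ} → Adj n → Fin n → Fin n → ℕ → Set
Walk {n} A x y t = Σ (Fin (suc t) → Fin n) λ w →
  w zero ≡ x × w (fromℕ t) ≡ y × (∀ (i : Fin t) → A (w (inject₁ i)) (w (suc i)) ≡ true)

Reachable : {n : ℕ} → Adj n → Fin n → Fin n → Set
Reachable A x y = ∃[ t ] Walk A x y t

Connected : {n : ℕ} → Adj n → Set
Connected A = ∀ x y → Reachable A x y

-- diameter ≤ r (infinite diameter of a disconnected graph is not ≤ r)
DiamAtMost : {n : ℕ} → Adj n → ℕ → Set
DiamAtMost A r = ∀ x y → ∃[ t ] (t ≤ r × Walk A x y t)

-- The edge uv of F lies in a cycle of length at most L: a path
-- p 0 = u, ..., p t = v of t+1 ≥ 3 distinct vertices, closed by the edge vu,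
-- giving a cycle of length t+1 ≤ L.
EdgeInCycleAtMost : {k : ℕ} → Graph k → Fin k → Fin k → ℕ → Set
EdgeInCycleAtMost {k} F u v L = Σ ℕ λ t → 2 ≤ t × suc t ≤ L ×
  Σ (Fin (suc t) → Fin k) λ p → Injective _≡_ _≡_ p ×
    p zero ≡ u × p (fromℕ t) ≡ v ×
    (∀ (i : Fin t) → adj F (p (inject₁ i)) (p (suc i)) ≡ true)

-- A has exactly c connected components: the components are indexed
-- surjectively by Fin c, with same index iff mutually reachable.
Components : {n : ℕ} → Adj n → ℕ → Set
Components {n} A c = Σ (Fin n → Fin c) λ f →
  (∀ j → ∃[ x ] f x ≡ j) × (∀ x y → (f x ≡ f y) ⇔ Reachable A x y)

HasCutEdge : {k : ℕ} → Graph k → Set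
HasCutEdge F = ∃[ u ] ∃[ v ] (adj F u v ≡ true ×
  ∃[ c ] ∃[ c' ] (Components (adj F) c × Components (removeEdge (adj F) u v) c' × c < c'))

-- rsat(n,F) = Ω(n^{1+1/m}): ∃ c>0 ∃ N ∀ n ≥ N, rsat(n,F) exists ⇒ rsat ≥ c n^{1+1/m}.
-- Equivalently (raising to the m-th power, c^m ≥ a/b rational > 0):
-- b · rsat^m ≥ a · n^{m+1}.
RsatOmega : {k : ℕ} → Graph k → ℕ → Set
RsatOmega F m = ∃[ a ] ∃[ b ] (1 ≤ a × 1 ≤ b × ∃[ N ] (∀ n → N ≤ n → ∀ e →
  IsRsat F n e → a * n ^ suc m ≤ b * e ^ m))

-- ∃ c, liminf_{n} rsat(n,F)/n ≤ c  (over n where rsat exists), i.e. the liminf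
-- is finite: ∃ C such that for infinitely many n, rsat(n,F) exists and ≤ C n.
LiminfLinear : {k : ℕ} → Graph k → Set
LiminfLinear F = ∃[ C ] (∀ N → ∃[ n ] (N ≤ n × ∃[ e ] (IsRsat F n e × e ≤ C * n)))

-- Under the hypotheses of (i) and (ii) every edge ab of F has a detour: an a–b walk of length at most
-- L avoiding ab. Adding a non-edge uv to an F-saturated graph G creates a copy of F, which must use uv
-- as the image of some edge ab; the detour of ab then maps to a u–v walk of length at most L in G.
-- So G has diameter at most L, and if G is d-regular on n vertices the Moore bound n ≤ (d+1)^L
-- together with nd = 2e gives n^(L+1) ≤ 4^L e^L.
--
-- For (iii), an edge uv whose removal leaves u and v joined has a detour of length at most |F|, so
-- without cut edges the bound above makes rsat superlinear. Conversely, if uv is a cut edge then a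
-- disjoint union of cliques on |F| − 1 vertices is regular and F-saturated: F is connected and does not
-- fit into one clique, while after joining x and y in different cliques the two sides of F − uv embed
-- into the cliques of x and y with uv sent to xy. Since rsat is a minimum, the existence of its value is
-- obtained by exhaustive search over the finitely many graphs on n vertices.

module Submission where

open import Defs hiding (sym)
open import Data.Nat using (ℕ; zero; suc; _+_; _*_; _^_; _≤_; _<_; _∸_; _<ᵇ_; z≤n; s≤s; _≤′_; ≤′-refl; ≤′-step; NonZero; >-nonZero)
open import Data.Nat.Properties hiding (_≟_)
open import Data.Nat.Solver using (module +-*-Solver)
open import Data.Fin using (Fin; zero; suc; toℕ; fromℕ; inject₁; _≟_; punchOut; combine; quotient; remainder; _↑ˡ_; _↑ʳ_)
import Data.Fin.Properties as Fin
open import Data.Fin.Permutation.Components using (transpose; transpose-inverse)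
open import Data.Bool using (Bool; true; false; _∧_; _∨_; not; if_then_else_)
import Data.Bool.Properties as Bool
open import Data.Product using (Σ; ∃; ∃-syntax; _×_; _,_; proj₁; proj₂)
open import Data.Sum using (_⊎_; inj₁; inj₂)
open import Relation.Nullary using (¬_; Dec; yes; no; contradiction)
open import Relation.Nullary.Decidable using (_×-dec_; _→-dec_; ¬?; isYes≗does; dec-true; dec-false)
open import Relation.Binary.PropositionalEquality
open import Function.Base using (_∘_)
import Data.Vec.Functional as Vector
open import Data.Nat.Induction using (<-rec)
open import Function.Definitions using (Injective)
open import Function.Bundles using (_⇔_; mk⇔; Equivalence)
open import Algebra.Properties.CommutativeSemigroup +-commutativeSemigroup using (interchange)

indicator : Bool → ℕ
indicator b = if b then 1 else 0

sum-cong : ∀ n {f g : Fin n → ℕ} → (∀ i → f i ≡ g i) → sumFin n f ≡ sumFin n g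
sum-cong zero    f≗g = refl
sum-cong (suc n) f≗g = cong₂ _+_ (f≗g zero) (sum-cong n (λ i → f≗g (suc i)))

sum-mono-≤ : ∀ n {f g : Fin n → ℕ} → (∀ i → f i ≤ g i) → sumFin n f ≤ sumFin n g
sum-mono-≤ zero    f≤g = z≤n
sum-mono-≤ (suc n) f≤g = +-mono-≤ (f≤g zero) (sum-mono-≤ n (λ i → f≤g (suc i)))

sum-mono-< : ∀ n {f g : Fin n → ℕ} → (∀ i → f i ≤ g i) → ∀ k → f k < g k → sumFin n f < sumFin n g
sum-mono-< (suc n) f≤g zero    fk<gk = +-mono-<-≤ fk<gk (sum-mono-≤ n (λ i → f≤g (suc i)))
sum-mono-< (suc n) f≤g (suc k) fk<gk = +-mono-≤-< (f≤g zero) (sum-mono-< n (λ i → f≤g (suc i)) k fk<gk)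

sum-+ : ∀ n (f g : Fin n → ℕ) → sumFin n (λ i → f i + g i) ≡ sumFin n f + sumFin n g
sum-+ zero    f g = refl
sum-+ (suc n) f g rewrite sum-+ n (λ i → f (suc i)) (λ i → g (suc i)) = interchange (f zero) (g zero) _ _

sum-const : ∀ n c → sumFin n (λ _ → c) ≡ c * n
sum-const zero    c = sym (*-zeroʳ c)
sum-const (suc n) c = trans (cong (c +_) (sum-const n c)) (sym (*-suc c n))

sum-*ʳ : ∀ n (f : Fin n → ℕ) c → sumFin n (λ i → f i * c) ≡ sumFin n f * c
sum-*ʳ zero    f c = refl
sum-*ʳ (suc n) f c rewrite sum-*ʳ n (λ i → f (suc i)) c = sym (*-distribʳ-+ c (f zero) _)

sum-swap : ∀ n m (f : Fin n → Fin m → ℕ) →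
  sumFin n (λ i → sumFin m (f i)) ≡ sumFin m (λ j → sumFin n (λ i → f i j))
sum-swap zero    m f = sym (sum-const m 0)
sum-swap (suc n) m f rewrite sum-swap n m (λ i → f (suc i)) =
  sym (sum-+ m (f zero) (λ j → sumFin n (λ i → f (suc i) j)))

sum-↑ : ∀ m p (f : Fin (m + p) → ℕ) →
  sumFin (m + p) f ≡ sumFin m (λ i → f (i ↑ˡ p)) + sumFin p (λ i → f (m ↑ʳ i))
sum-↑ zero    p f = refl
sum-↑ (suc m) p f rewrite sum-↑ m p (λ i → f (suc i)) = sym (+-assoc (f zero) _ _)

sum-combine : ∀ q s (f : Fin (q * s) → ℕ) → sumFin (q * s) f ≡ sumFin q (λ b → sumFin s (λ r → f (combine b r)))
sum-combine zero    s f = refl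
sum-combine (suc q) s f =
  trans (sum-↑ s (q * s) f) (cong (sumFin s (λ r → f (r ↑ˡ (q * s))) +_) (sum-combine q s (λ i → f (s ↑ʳ i))))

indicator-mono : ∀ {a b} → (a ≡ true → b ≡ true) → indicator a ≤ indicator b
indicator-mono {false} a⇒b = z≤n
indicator-mono {true}  a⇒b rewrite a⇒b refl = ≤-refl

indicator-∨ : ∀ a b → indicator (a ∨ b) ≤ indicator a + indicator b
indicator-∨ true  b = s≤s z≤n
indicator-∨ false b = ≤-refl

indicator-∧-not : ∀ b e → (e ≡ true → b ≡ true) → indicator (b ∧ not e) + indicator e ≡ indicator b
indicator-∧-not b false _   = trans (+-identityʳ _) (cong indicator (Bool.∧-identityʳ b))
indicator-∧-not b true  e⇒b rewrite e⇒b refl = refl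

count-cong : ∀ n {p q : Fin n → Bool} → (∀ i → p i ≡ q i) → countFin n p ≡ countFin n q
count-cong n p≗q = sum-cong n (λ i → cong indicator (p≗q i))

count-mono-≤ : ∀ n {p q : Fin n → Bool} → (∀ i → p i ≡ true → q i ≡ true) → countFin n p ≤ countFin n q
count-mono-≤ n p⊆q = sum-mono-≤ n (λ i → indicator-mono (p⊆q i))

count-mono-< : ∀ n {p q : Fin n → Bool} → (∀ i → p i ≡ true → q i ≡ true) →
  ∀ k → p k ≡ false → q k ≡ true → countFin n p < countFin n q
count-mono-< n p⊆q k pk qk = sum-mono-< n (λ i → indicator-mono (p⊆q i)) k
  (subst₂ (λ a b → indicator a < indicator b) (sym pk) (sym qk) (s≤s z≤n))

count-full : ∀ n {p : Fin n → Bool} → (∀ i → p i ≡ true) → countFin n p ≡ n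
count-full n {p} all = trans (count-cong n all) (trans (sum-const n 1) (*-identityˡ n))

count-≤ : ∀ n (p : Fin n → Bool) → countFin n p ≤ n
count-≤ n p = subst (countFin n p ≤_) (count-full n {λ _ → true} (λ _ → refl)) (count-mono-≤ n (λ _ _ → refl))

≡⇒== : ∀ {n} {i j : Fin n} → i ≡ j → (i == j) ≡ true
≡⇒== {i = i} {j} i≡j = trans (isYes≗does (i ≟ j)) (dec-true (i ≟ j) i≡j)

≢⇒== : ∀ {n} {i j : Fin n} → ¬ i ≡ j → (i == j) ≡ false
≢⇒== {i = i} {j} i≢j = trans (isYes≗does (i ≟ j)) (dec-false (i ≟ j) i≢j)

==-refl : ∀ {n} (i : Fin n) → (i == i) ≡ true
==-refl i = ≡⇒== refl

==⇒≡ : ∀ {n} {i j : Fin n} → (i == j) ≡ true → i ≡ j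
==⇒≡ {i = i} {j} i==j with i ≟ j
... | yes i≡j = i≡j
==⇒≡ () | no _

==-suc : ∀ {n} (i j : Fin n) → (suc i == suc j) ≡ (i == j)
==-suc i j with i ≟ j
... | yes _ = refl
... | no  _ = refl

==-comm : ∀ {n} (i j : Fin n) → (i == j) ≡ (j == i)
==-comm i j with i ≟ j
... | yes refl = sym (==-refl i)
... | no  i≢j  = sym (≢⇒== (λ j≡i → i≢j (sym j≡i)))

count-== : ∀ n (x : Fin n) → countFin n (x ==_) ≡ 1
count-== (suc n) zero    = cong suc (trans (count-cong n (λ _ → refl)) (sum-const n 0))
count-== (suc n) (suc x) = trans (count-cong n (λ i → ==-suc x i)) (count-== n x)

∨-true : ∀ {a b} → (a ∨ b) ≡ true → a ≡ true ⊎ b ≡ true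
∨-true {true}  _   = inj₁ refl
∨-true {false} a∨b = inj₂ a∨b

⇏⇒true×false : ∀ {a b : Bool} → ¬ (a ≡ true → b ≡ true) → a ≡ true × b ≡ false
⇏⇒true×false {true}  {false} _   = refl , refl
⇏⇒true×false {false}         a⇏b = contradiction (λ ()) a⇏b
⇏⇒true×false {true}  {true}  a⇏b = contradiction (λ _ → refl) a⇏b

bool-ext : ∀ {a b : Bool} → (a ≡ true → b ≡ true) → (b ≡ true → a ≡ true) → a ≡ b
bool-ext {true}  a⇒b _   = sym (a⇒b refl)
bool-ext {false} {false} _ _ = refl
bool-ext {false} {true}  _ b⇒a = b⇒a refl

SymAdj : ∀ {n} → Adj n → Set
SymAdj A = ∀ i j → A i j ≡ A j i

joins : ∀ {n} → Fin n → Fin n → Fin n → Fin n → Bool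
joins a b i j = (i == a ∧ j == b) ∨ (i == b ∧ j == a)

SameEdge : ∀ {n} → Fin n → Fin n → Fin n → Fin n → Set
SameEdge a b i j = (i ≡ a × j ≡ b) ⊎ (i ≡ b × j ≡ a)

joins-intro : ∀ {n} {a b i j : Fin n} → SameEdge a b i j → joins a b i j ≡ true
joins-intro {a = a} {b} (inj₁ (refl , refl)) rewrite ==-refl a | ==-refl b = refl
joins-intro {a = a} {b} (inj₂ (refl , refl)) rewrite ==-refl a | ==-refl b = Bool.∨-zeroʳ _

joins-elim : ∀ {n} {a b i j : Fin n} → joins a b i j ≡ true → SameEdge a b i j
joins-elim {a = a} {b} {i} {j} h with ∨-true {i == a ∧ j == b} h
... | inj₁ e = inj₁ (==⇒≡ (Bool.∧-conicalˡ _ _ e) , ==⇒≡ (Bool.∧-conicalʳ _ _ e))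
... | inj₂ e = inj₂ (==⇒≡ (Bool.∧-conicalˡ _ _ e) , ==⇒≡ (Bool.∧-conicalʳ _ _ e))

joins-sym : ∀ {n} (a b i j : Fin n) → joins a b i j ≡ joins a b j i
joins-sym a b i j = trans (Bool.∨-comm (i == a ∧ j == b) _)
  (cong₂ _∨_ (Bool.∧-comm (i == b) (j == a)) (Bool.∧-comm (i == a) (j == b)))

removeEdge-sym : ∀ {n} {A : Adj n} → SymAdj A → ∀ a b → SymAdj (removeEdge A a b)
removeEdge-sym A-sym a b i j = cong₂ (λ p q → p ∧ not q) (A-sym i j) (joins-sym a b i j)

addEdge-old : ∀ {n} (A : Adj n) {a b i j} → A i j ≡ true → addEdge A a b i j ≡ true
addEdge-old A Aij rewrite Aij = refl

addEdge-new : ∀ {n} (A : Adj n) {a b i j} → SameEdge a b i j → addEdge A a b i j ≡ true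
addEdge-new A {i = i} {j} ij=ab rewrite joins-intro ij=ab = Bool.∨-zeroʳ (A i j)

removeEdge-⊆ : ∀ {n} (A : Adj n) a b i j → removeEdge A a b i j ≡ true → A i j ≡ true
removeEdge-⊆ A a b i j h = Bool.∧-conicalˡ _ _ h

removeEdge-keeps : ∀ {n} (A : Adj n) {a b i j} → A i j ≡ true → ¬ SameEdge a b i j → removeEdge A a b i j ≡ true
removeEdge-keeps A {a} {b} {i} {j} Aij ¬same with joins a b i j in eq
... | false = cong (_∧ true) Aij
... | true  = contradiction (joins-elim eq) ¬same

removeEdge-removes : ∀ {n} (A : Adj n) {a b i j} → A i j ≡ true → removeEdge A a b i j ≡ false → SameEdge a b i j
removeEdge-removes A {a} {b} {i} {j} Aij removed with joins a b i j in eq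
... | true  = joins-elim eq
... | false = contradiction (trans (sym (cong (_∧ true) Aij)) removed) λ ()

data Walk′ {n} (A : Adj n) : Fin n → Fin n → ℕ → Set where
  []  : ∀ {x} → Walk′ A x x 0
  _∷_ : ∀ {x y z t} → A x y ≡ true → Walk′ A y z t → Walk′ A x z (suc t)

infixr 5 _∷_

walk⇒walk′ : ∀ {n} {A : Adj n} t {x y} → Walk A x y t → Walk′ A x y t
walk⇒walk′ zero    (w , refl , refl , _) = []
walk⇒walk′ (suc t) (w , refl , w-end , steps) =
  steps zero ∷ walk⇒walk′ t ((λ i → w (suc i)) , refl , w-end , (λ i → steps (suc i)))

walk′⇒walk : ∀ {n} {A : Adj n} {t x y} → Walk′ A x y t → Walk A x y t
walk′⇒walk {x = x} [] = (λ _ → x) , refl , refl , λ ()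
walk′⇒walk {A = A} {x = x} (Axy ∷ rest) with walk′⇒walk rest
... | w , refl , w-end , steps = prepend , refl , w-end , prepend-steps
  where
  prepend : Fin _ → Fin _
  prepend zero    = x
  prepend (suc i) = w i
  prepend-steps : ∀ i → A (prepend (inject₁ i)) (prepend (suc i)) ≡ true
  prepend-steps zero    = Axy
  prepend-steps (suc i) = steps i

_∷ʳ_ : ∀ {n} {A : Adj n} {x y z t} → Walk′ A x y t → A y z ≡ true → Walk′ A x z (suc t)
[]           ∷ʳ Ayz = Ayz ∷ []
(Axw ∷ rest) ∷ʳ Ayz = Axw ∷ (rest ∷ʳ Ayz)

_++_ : ∀ {n} {A : Adj n} {x y z s t} → Walk′ A x y s → Walk′ A y z t → Walk′ A x z (s + t)
[]           ++ rest′ = rest′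
(Axw ∷ rest) ++ rest′ = Axw ∷ (rest ++ rest′)

reverse : ∀ {n} {A : Adj n} → SymAdj A → ∀ {x y t} → Walk′ A x y t → Walk′ A y x t
reverse A-sym [] = []
reverse A-sym {x} (_∷_ {y = y} Axy rest) = reverse A-sym rest ∷ʳ trans (A-sym y x) Axy

map : ∀ {n m} {A : Adj n} {B : Adj m} (φ : Fin n → Fin m) → (∀ i j → A i j ≡ true → B (φ i) (φ j) ≡ true) →
  ∀ {x y t} → Walk′ A x y t → Walk′ B (φ x) (φ y) t
map φ hom []           = []
map φ hom (Axy ∷ rest) = hom _ _ Axy ∷ map φ hom rest

Reach : ∀ {n} → Adj n → Fin n → Fin n → Set
Reach A x y = ∃[ t ] Walk′ A x y t

reachable⇒reach : ∀ {n} {A : Adj n} {x y} → Reachable A x y → Reach A x y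
reachable⇒reach (t , w) = t , walk⇒walk′ t w

reach⇒reachable : ∀ {n} {A : Adj n} {x y} → Reach A x y → Reachable A x y
reach⇒reachable (t , w) = t , walk′⇒walk w

reach-refl : ∀ {n} {A : Adj n} {x} → Reach A x x
reach-refl = 0 , []

reach-edge : ∀ {n} {A : Adj n} {x y} → A x y ≡ true → Reach A x y
reach-edge Axy = 1 , Axy ∷ []

reach-sym : ∀ {n} {A : Adj n} → SymAdj A → ∀ {x y} → Reach A x y → Reach A y x
reach-sym A-sym (t , w) = t , reverse A-sym w

reach-trans : ∀ {n} {A : Adj n} {x y z} → Reach A x y → Reach A y z → Reach A x z
reach-trans (s , w) (t , w′) = s + t , w ++ w′

-- Balls around a vertex

anyᵇ : ∀ n → (Fin n → Bool) → Bool
anyᵇ zero    p = false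
anyᵇ (suc n) p = p zero ∨ anyᵇ n (λ i → p (suc i))

anyᵇ-intro : ∀ n (p : Fin n → Bool) i → p i ≡ true → anyᵇ n p ≡ true
anyᵇ-intro (suc n) p zero    pi rewrite pi = refl
anyᵇ-intro (suc n) p (suc i) pi rewrite anyᵇ-intro n (λ j → p (suc j)) i pi = Bool.∨-zeroʳ (p zero)

anyᵇ-elim : ∀ n (p : Fin n → Bool) → anyᵇ n p ≡ true → ∃[ i ] p i ≡ true
anyᵇ-elim (suc n) p any with ∨-true {p zero} any
... | inj₁ p0 = zero , p0
... | inj₂ ps with anyᵇ-elim n (λ i → p (suc i)) ps
...   | i , pi = suc i , pi

indicator-anyᵇ : ∀ n (p : Fin n → Bool) → indicator (anyᵇ n p) ≤ countFin n p
indicator-anyᵇ zero    p = z≤n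
indicator-anyᵇ (suc n) p =
  ≤-trans (indicator-∨ (p zero) _) (+-monoʳ-≤ (indicator (p zero)) (indicator-anyᵇ n (λ i → p (suc i))))

module Ball {n : ℕ} (A : Adj n) (x : Fin n) where

  ball : ℕ → Fin n → Bool
  ball zero    z = z == x
  ball (suc t) z = ball t z ∨ anyᵇ n (λ y → A z y ∧ ball t y)

  ball-step : ∀ {t z y} → A z y ≡ true → ball t y ≡ true → ball (suc t) z ≡ true
  ball-step {t} {z} {y} Azy y∈ =
    trans (cong (ball t z ∨_) (anyᵇ-intro n _ y (cong₂ _∧_ Azy y∈))) (Bool.∨-zeroʳ (ball t z))

  ball-⊆-suc : ∀ t z → ball t z ≡ true → ball (suc t) z ≡ true
  ball-⊆-suc t z z∈ rewrite z∈ = refl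

  ball-mono : ∀ {t t′} → t ≤ t′ → ∀ z → ball t z ≡ true → ball t′ z ≡ true
  ball-mono t≤t′ z = go (≤⇒≤′ t≤t′)
    where
    go : ∀ {t t′} → t ≤′ t′ → ball t z ≡ true → ball t′ z ≡ true
    go ≤′-refl             z∈ = z∈
    go (≤′-step {n = m} le) z∈ = ball-⊆-suc m z (go le z∈)

  walk⇒ball : ∀ {z s} → Walk′ A z x s → ball s z ≡ true
  walk⇒ball []           = ==-refl x
  walk⇒ball (_∷_ {t = s} Azy rest) = ball-step {s} Azy (walk⇒ball rest)

  ball⇒walk : ∀ t z → ball t z ≡ true → ∃[ s ] (s ≤ t × Walk′ A z x s)
  ball⇒walk zero    z z∈ = 0 , z≤n , subst (λ w → Walk′ A w x 0) (sym (==⇒≡ z∈)) []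
  ball⇒walk (suc t) z z∈ with ∨-true {ball t z} z∈
  ... | inj₁ z∈t with ball⇒walk t z z∈t
  ...   | s , s≤t , w = s , m≤n⇒m≤1+n s≤t , w
  ball⇒walk (suc t) z z∈ | inj₂ any with anyᵇ-elim n _ any
  ...   | y , Azy∧y∈ with ball⇒walk t y (Bool.∧-conicalʳ _ _ Azy∧y∈)
  ...     | s , s≤t , w = suc s , s≤s s≤t , Bool.∧-conicalˡ _ _ Azy∧y∈ ∷ w

  module _ (A-sym : SymAdj A) {d : ℕ} (deg≤ : ∀ y → countFin n (A y) ≤ d) where

    in-neighbours-≤ : ∀ y b → countFin n (λ z → A z y ∧ b) ≤ indicator b * d
    in-neighbours-≤ y true  = begin
      countFin n (λ z → A z y ∧ true) ≡⟨ count-cong n (λ z → trans (Bool.∧-identityʳ (A z y)) (A-sym z y)) ⟩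
      countFin n (A y)                ≤⟨ deg≤ y ⟩
      d                               ≡⟨ sym (+-identityʳ d) ⟩
      1 * d                           ∎
      where open ≤-Reasoning
    in-neighbours-≤ y false = ≤-reflexive (trans (count-cong n (λ z → Bool.∧-zeroʳ (A z y))) (sum-const n 0))

    ball-size-suc : ∀ t → countFin n (ball (suc t)) ≤ countFin n (ball t) * suc d
    ball-size-suc t = begin
      countFin n (ball (suc t))
        ≤⟨ sum-mono-≤ n (λ z → ≤-trans (indicator-∨ (ball t z) _) (+-monoʳ-≤ _ (indicator-anyᵇ n _))) ⟩
      sumFin n (λ z → indicator (ball t z) + countFin n (λ y → A z y ∧ ball t y))
        ≡⟨ sum-+ n _ _ ⟩
      countFin n (ball t) + sumFin n (λ z → countFin n (λ y → A z y ∧ ball t y))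
        ≡⟨ cong (countFin n (ball t) +_) (sum-swap n n (λ z y → indicator (A z y ∧ ball t y))) ⟩
      countFin n (ball t) + sumFin n (λ y → countFin n (λ z → A z y ∧ ball t y))
        ≤⟨ +-monoʳ-≤ _ (sum-mono-≤ n (λ y → in-neighbours-≤ y (ball t y))) ⟩
      countFin n (ball t) + sumFin n (λ y → indicator (ball t y) * d)
        ≡⟨ cong (countFin n (ball t) +_) (sum-*ʳ n (λ y → indicator (ball t y)) d) ⟩
      countFin n (ball t) + countFin n (ball t) * d
        ≡⟨ sym (*-suc (countFin n (ball t)) d) ⟩
      countFin n (ball t) * suc d ∎
      where open ≤-Reasoning

    ball-size : ∀ t → countFin n (ball t) ≤ suc d ^ t
    ball-size zero    = ≤-reflexive (trans (count-cong n (λ z → ==-comm z x)) (count-== n x))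
    ball-size (suc t) = begin
      countFin n (ball (suc t)) ≤⟨ ball-size-suc t ⟩
      countFin n (ball t) * suc d ≤⟨ *-monoˡ-≤ (suc d) (ball-size t) ⟩
      suc d ^ t * suc d ≡⟨ *-comm (suc d ^ t) (suc d) ⟩
      suc d ^ suc t ∎
      where open ≤-Reasoning

  Stable : ℕ → Set
  Stable t = ∀ z → ball (suc t) z ≡ true → ball t z ≡ true

  stable? : ∀ t → Dec (Stable t)
  stable? t = Fin.all? (λ z → (ball (suc t) z Bool.≟ true) →-dec (ball t z Bool.≟ true))

  stable-suc : ∀ t → Stable t → Stable (suc t)
  stable-suc t st z z∈ with ∨-true {ball (suc t) z} z∈
  ... | inj₁ z∈′ = z∈′
  ... | inj₂ any with anyᵇ-elim n _ any
  ...   | y , Azy∧y∈ = ball-step {t} (Bool.∧-conicalˡ _ _ Azy∧y∈) (st y (Bool.∧-conicalʳ _ _ Azy∧y∈))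

  stable-+ : ∀ t → Stable t → ∀ j z → ball (j + t) z ≡ true → ball t z ≡ true
  stable-+ t st zero    z z∈ = z∈
  stable-+ t st (suc j) z z∈ = stable-+ t st j z (stable-from j z z∈)
    where
    stable-from : ∀ j → Stable (j + t)
    stable-from zero    = st
    stable-from (suc j) = stable-suc (j + t) (stable-from j)

  stable-or-grows : ∀ t → (∃[ t′ ] (t′ ≤ t × Stable t′)) ⊎ (suc t ≤ countFin n (ball t))
  stable-or-grows zero = inj₂ (≤-reflexive (sym (trans (count-cong n (λ z → ==-comm z x)) (count-== n x))))
  stable-or-grows (suc t) with stable-or-grows t
  ... | inj₁ (t′ , t′≤t , st) = inj₁ (t′ , m≤n⇒m≤1+n t′≤t , st)
  ... | inj₂ grown with stable? t
  ...   | yes st = inj₁ (t , n≤1+n t , st)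
  ...   | no ¬st with Fin.¬∀⟶∃¬ n _ (λ z → (ball (suc t) z Bool.≟ true) →-dec (ball t z Bool.≟ true)) ¬st
  ...     | z , new with ⇏⇒true×false new
  ...       | z∈ , z∉ = inj₂ (≤-trans (s≤s grown) (count-mono-< n (ball-⊆-suc t) z z∉ z∈))

  ball-saturated : ∀ s z → ball s z ≡ true → ball n z ≡ true
  ball-saturated s z z∈ with stable-or-grows n
  ... | inj₂ n<count = contradiction (count-≤ n (ball n)) (<⇒≱ n<count)
  ... | inj₁ (t′ , t′≤n , st) with ≤-total s t′
  ...   | inj₁ s≤t′ = ball-mono (≤-trans s≤t′ t′≤n) z z∈
  ...   | inj₂ t′≤s = ball-mono t′≤n z
    (stable-+ t′ st (s ∸ t′) z (subst (λ m → ball m z ≡ true) (sym (m∸n+n≡m t′≤s)) z∈))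

  reach⇒ball : ∀ {z} → Reach A z x → ball n z ≡ true
  reach⇒ball (s , w) = ball-saturated s _ (walk⇒ball w)

  ball⇒reach : ∀ {z} → ball n z ≡ true → Reach A z x
  ball⇒reach {z} z∈ with ball⇒walk n z z∈
  ... | s , _ , w = s , w

<ᵇ-trichotomy : ∀ a b → ¬ a ≡ b → indicator (a <ᵇ b) + indicator (b <ᵇ a) ≡ 1
<ᵇ-trichotomy zero    zero    a≢b = contradiction refl a≢b
<ᵇ-trichotomy zero    (suc b) a≢b = refl
<ᵇ-trichotomy (suc a) zero    a≢b = refl
<ᵇ-trichotomy (suc a) (suc b) a≢b = <ᵇ-trichotomy a b (λ a≡b → a≢b (cong suc a≡b))

adj-split-by-order : ∀ {n} (G : Graph n) i j →
  indicator (adj G i j) ≡ indicator (adj G i j ∧ (toℕ i <ᵇ toℕ j)) + indicator (adj G i j ∧ (toℕ j <ᵇ toℕ i))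
adj-split-by-order G i j with adj G i j in Gij
... | false = refl
... | true  = sym (<ᵇ-trichotomy (toℕ i) (toℕ j) i≢j)
  where
  i≢j : ¬ toℕ i ≡ toℕ j
  i≢j i≡j with Fin.toℕ-injective i≡j
  ... | refl = contradiction (trans (sym Gij) (irrefl G i)) λ ()

handshake : ∀ {n} (G : Graph n) → sumFin n (degree G) ≡ edges G + edges G
handshake {n} G = begin
  sumFin n (degree G)
    ≡⟨ sum-cong n (λ i → trans (sum-cong n (adj-split-by-order G i)) (sum-+ n _ _)) ⟩
  sumFin n (λ i → countFin n (λ j → adj G i j ∧ (toℕ i <ᵇ toℕ j))
                 + countFin n (λ j → adj G i j ∧ (toℕ j <ᵇ toℕ i)))
    ≡⟨ sum-+ n _ _ ⟩
  edges G + sumFin n (λ i → countFin n (λ j → adj G i j ∧ (toℕ j <ᵇ toℕ i)))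
    ≡⟨ cong (edges G +_) (sum-swap n n (λ i j → indicator (adj G i j ∧ (toℕ j <ᵇ toℕ i)))) ⟩
  edges G + sumFin n (λ j → countFin n (λ i → adj G i j ∧ (toℕ j <ᵇ toℕ i)))
    ≡⟨ cong (edges G +_) (sum-cong n (λ j → count-cong n (λ i → cong (_∧ (toℕ j <ᵇ toℕ i)) (Graph.sym G i j)))) ⟩
  edges G + edges G ∎
  where open ≡-Reasoning

regular-handshake : ∀ {n} (G : Graph n) {d} → (∀ i → degree G i ≡ d) → n * d ≡ edges G + edges G
regular-handshake {n} G {d} deg≡d = begin
  n * d               ≡⟨ *-comm n d ⟩
  d * n               ≡⟨ sum-const n d ⟨
  sumFin n (λ _ → d)  ≡⟨ sum-cong n deg≡d ⟨
  sumFin n (degree G) ≡⟨ handshake G ⟩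
  edges G + edges G   ∎
  where open ≡-Reasoning

-- Saturated graphs have small diameter

ShortDetours : ∀ {k} → Graph k → ℕ → Set
ShortDetours F L = ∀ a b → adj F a b ≡ true → ∃[ s ] (s ≤ L × Walk′ (removeEdge (adj F) a b) a b s)

same-edge-injective : ∀ {k n} {φ : Fin k → Fin n} → Injective _≡_ _≡_ φ → ∀ {u v a b i j} →
  SameEdge u v (φ a) (φ b) → SameEdge u v (φ i) (φ j) → SameEdge a b i j
same-edge-injective φ-inj (inj₁ (a↦u , b↦v)) (inj₁ (i↦u , j↦v)) = inj₁ (φ-inj (trans i↦u (sym a↦u)) , φ-inj (trans j↦v (sym b↦v)))
same-edge-injective φ-inj (inj₁ (a↦u , b↦v)) (inj₂ (i↦v , j↦u)) = inj₂ (φ-inj (trans i↦v (sym b↦v)) , φ-inj (trans j↦u (sym a↦u)))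
same-edge-injective φ-inj (inj₂ (a↦v , b↦u)) (inj₁ (i↦u , j↦v)) = inj₂ (φ-inj (trans i↦u (sym b↦u)) , φ-inj (trans j↦v (sym a↦v)))
same-edge-injective φ-inj (inj₂ (a↦v , b↦u)) (inj₂ (i↦v , j↦u)) = inj₁ (φ-inj (trans i↦v (sym a↦v)) , φ-inj (trans j↦u (sym b↦u)))

module _ {k n} (F : Graph k) (G : Graph n) {u v : Fin n} (φ : Fin k → Fin n)
         (φ-hom : ∀ i j → adj F i j ≡ true → addEdge (adj G) u v (φ i) (φ j) ≡ true) where

  copy-uses-new-edge : ¬ Copy F (adj G) → Injective _≡_ _≡_ φ →
    ∃[ a ] ∃[ b ] (adj F a b ≡ true × SameEdge u v (φ a) (φ b))
  copy-uses-new-edge no-copy φ-inj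
    with Fin.any? (λ a → Fin.any? (λ b → (adj F a b Bool.≟ true) ×-dec (adj G (φ a) (φ b) Bool.≟ false)))
  ... | yes (a , b , Fab , ¬Gab) = a , b , Fab , joins-elim (trans (cong (_∨ _) (sym ¬Gab)) (φ-hom a b Fab))
  ... | no none = contradiction (φ , (λ {x y} → φ-inj {x} {y}) , φ-hom′) no-copy
    where
    φ-hom′ : ∀ i j → adj F i j ≡ true → adj G (φ i) (φ j) ≡ true
    φ-hom′ i j Fij with adj G (φ i) (φ j) in Gij
    ... | true  = refl
    ... | false = contradiction (i , j , Fij , Gij) none

  copy-minus-edge : Injective _≡_ _≡_ φ → ∀ {a b} → SameEdge u v (φ a) (φ b) →
    ∀ i j → removeEdge (adj F) a b i j ≡ true → adj G (φ i) (φ j) ≡ true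
  copy-minus-edge φ-inj ab↦uv i j F-ab-ij with adj G (φ i) (φ j) in Gij
  ... | true  = refl
  ... | false = contradiction (same-edge-injective φ-inj ab↦uv ij↦uv) ij≠ab
    where
    ij↦uv : SameEdge u v (φ i) (φ j)
    ij↦uv = joins-elim (trans (cong (_∨ _) (sym Gij)) (φ-hom i j (removeEdge-⊆ (adj F) _ _ i j F-ab-ij)))
    ij≠ab : ¬ SameEdge _ _ i j
    ij≠ab ij=ab = contradiction (trans (cong not (sym (joins-intro ij=ab))) (Bool.∧-conicalʳ _ _ F-ab-ij)) λ ()

orient : ∀ {n} {A : Adj n} → SymAdj A → ∀ {u v x y t} → SameEdge u v x y → Walk′ A x y t → Walk′ A u v t
orient A-sym (inj₁ (refl , refl)) w = w
orient A-sym (inj₂ (refl , refl)) w = reverse A-sym w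

saturated⇒short-walks : ∀ {k n} (F : Graph k) (G : Graph n) {L} → 1 ≤ L → ShortDetours F L → Saturated F G →
  ∀ u v → ∃[ s ] (s ≤ L × Walk′ (adj G) u v s)
saturated⇒short-walks F G 1≤L detour (no-copy , saturated) u v with u ≟ v
... | yes refl = 0 , z≤n , []
... | no u≢v with adj G u v in Guv
...   | true  = 1 , 1≤L , Guv ∷ []
...   | false with saturated u v u≢v Guv
...     | φ , φ-inj , φ-hom with copy-uses-new-edge F G φ φ-hom no-copy φ-inj
...       | a , b , Fab , ab↦uv with detour a b Fab
...         | s , s≤L , w = s , s≤L , orient (Graph.sym G) ab↦uv (map φ (copy-minus-edge F G φ φ-hom φ-inj ab↦uv) w)

-- Parts (i) and (ii)

^-distribʳ-* : ∀ a b L → (a * b) ^ L ≡ a ^ L * b ^ L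
^-distribʳ-* a b zero    = refl
^-distribʳ-* a b (suc L) rewrite ^-distribʳ-* a b L = interchange′ a b (a ^ L) (b ^ L)
  where
  open +-*-Solver
  interchange′ : ∀ a b x y → (a * b) * (x * y) ≡ (a * x) * (b * y)
  interchange′ = solve 4 (λ a b x y → (a :* b) :* (x :* y) := (a :* x) :* (b :* y)) refl

moore-arithmetic : ∀ {n d e} L → 2 ≤ n → n ≤ suc d ^ L → n * d ≡ e + e → n ^ suc L ≤ 4 ^ L * e ^ L
moore-arithmetic {d = zero} L 2≤n n≤1 _ = contradiction (≤-trans n≤1 (≤-reflexive (^-zeroˡ L))) (<⇒≱ 2≤n)
moore-arithmetic {n} {suc D} {e} L 2≤n n≤ball nd≡2e = begin
  n * n ^ L               ≤⟨ *-monoˡ-≤ (n ^ L) (≤-trans n≤ball (^-monoˡ-≤ L D+2≤2D+2)) ⟩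
  (2 * suc D) ^ L * n ^ L ≡⟨ ^-distribʳ-* (2 * suc D) n L ⟨
  (2 * suc D * n) ^ L     ≡⟨ cong (_^ L) 2dn≡4e ⟩
  (4 * e) ^ L             ≡⟨ ^-distribʳ-* 4 e L ⟩
  4 ^ L * e ^ L           ∎
  where
  open ≤-Reasoning
  D+2≤2D+2 : suc (suc D) ≤ 2 * suc D
  D+2≤2D+2 = subst (_≤ 2 * suc D) (+-comm (suc D) 1) (+-monoʳ-≤ (suc D) (s≤s z≤n))
  2dn≡4e : 2 * suc D * n ≡ 4 * e
  2dn≡4e = trans (*-assoc 2 (suc D) n) (trans (cong (2 *_) (trans (*-comm (suc D) n) nd≡2e)) (double e))
    where
    open +-*-Solver
    double : ∀ e → 2 * (e + e) ≡ 4 * e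
    double = solve 1 (λ e → con 2 :* (e :+ e) := con 4 :* e) refl

regular-saturated-size : ∀ {k n} (F : Graph k) (G : Graph n) {L} → 1 ≤ L → ShortDetours F L →
  Regular G → Saturated F G → 2 ≤ n → n ^ suc L ≤ 4 ^ L * edges G ^ L
regular-saturated-size {n = n} F G {L} 1≤L detour (d , deg≡d) sat 2≤n@(s≤s (s≤s z≤n)) =
  moore-arithmetic L 2≤n n≤ball (regular-handshake G deg≡d)
  where
  open Ball (adj G) zero
  everyone-close : ∀ z → ball L z ≡ true
  everyone-close z with saturated⇒short-walks F G 1≤L detour sat z zero
  ... | s , s≤L , w = ball-mono s≤L z (walk⇒ball w)
  n≤ball : n ≤ suc d ^ L
  n≤ball = subst (_≤ suc d ^ L) (count-full n everyone-close) (ball-size (Graph.sym G) (λ y → ≤-reflexive (deg≡d y)) L)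

shortDetours⇒rsatOmega : ∀ {k} (F : Graph k) L → 1 ≤ L → ShortDetours F L → RsatOmega F L
shortDetours⇒rsatOmega F L 1≤L detour = 1 , 4 ^ L , ≤-refl , m^n>0 4 L , 2 ,
  λ { n 2≤n e ((G , reg , sat , refl) , _) →
        ≤-trans (≤-reflexive (*-identityˡ _)) (regular-saturated-size F G 1≤L detour reg sat 2≤n) }

first-last-step : ∀ t → 2 ≤ t → (i : Fin t) → inject₁ i ≡ zero → ¬ suc i ≡ fromℕ t
first-last-step (suc zero)    (s≤s ())
first-last-step (suc (suc t)) _ zero    _ ()
first-last-step (suc (suc t)) _ (suc i) () _

cycles⇒shortDetours : ∀ {k} (F : Graph k) m →
  (∀ u v → adj F u v ≡ true → EdgeInCycleAtMost F u v (suc m)) → ShortDetours F m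
cycles⇒shortDetours F m cycle u v Fuv with cycle u v Fuv
... | t , 2≤t , s≤s t≤m , p , p-inj , refl , refl , steps = t , t≤m , walk⇒walk′ t (p , refl , refl , steps′)
  where
  steps′ : ∀ i → removeEdge (adj F) (p zero) (p (fromℕ t)) (p (inject₁ i)) (p (suc i)) ≡ true
  steps′ i = removeEdge-keeps (adj F) (steps i) λ
    { (inj₁ (i↦u , i+1↦v)) → first-last-step t 2≤t i (p-inj i↦u) (p-inj i+1↦v)
    ; (inj₂ (i↦v , _))     → Fin.fromℕ≢inject₁ (sym (p-inj i↦v)) }

diameter⇒shortDetours : ∀ {k} (F : Graph k) r →
  (∀ u v → adj F u v ≡ true → DiamAtMost (removeEdge (adj F) u v) r) → ShortDetours F r
diameter⇒shortDetours F r diam u v Fuv with diam u v Fuv u v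
... | t , t≤r , w = t , t≤r , walk⇒walk′ t w

-- Cut edges

module EdgeRemoval {k : ℕ} (F : Graph k) (u v : Fin k) where

  F∖uv : Adj k
  F∖uv = removeEdge (adj F) u v

  F∖uv-sym : SymAdj F∖uv
  F∖uv-sym = removeEdge-sym (Graph.sym F) u v

  reach-from-ends : ∀ {y z t} → Walk′ (adj F) y z t →
    Reach F∖uv u y ⊎ Reach F∖uv v y → Reach F∖uv u z ⊎ Reach F∖uv v z
  reach-from-ends [] from-end = from-end
  reach-from-ends {y} (_∷_ {y = y′} Fyy′ rest) from-end with F∖uv y y′ in kept
  ... | true  = reach-from-ends rest (Data.Sum.map (extend kept) (extend kept) from-end)
    where extend : ∀ {a b c} → F∖uv b c ≡ true → Reach F∖uv a b → Reach F∖uv a c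
          extend bc a⇝b = reach-trans a⇝b (reach-edge bc)
  ... | false with removeEdge-removes (adj F) Fyy′ kept
  ...   | inj₁ (_ , refl) = reach-from-ends rest (inj₂ reach-refl)
  ...   | inj₂ (_ , refl) = reach-from-ends rest (inj₁ reach-refl)

  reach-lift : Reach F∖uv u v → ∀ {x y t} → Walk′ (adj F) x y t → Reach F∖uv x y
  reach-lift u⇝v [] = reach-refl
  reach-lift u⇝v {x} (_∷_ {y = y′} Fxy′ rest) with F∖uv x y′ in kept
  ... | true  = reach-trans (reach-edge kept) (reach-lift u⇝v rest)
  ... | false with removeEdge-removes (adj F) Fxy′ kept
  ...   | inj₁ (refl , refl) = reach-trans u⇝v (reach-lift u⇝v rest)
  ...   | inj₂ (refl , refl) = reach-trans (reach-sym F∖uv-sym u⇝v) (reach-lift u⇝v rest)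

  open Ball F∖uv u public

  -- a walk to u can be shortened to k steps (ball-saturated), so this decides reachability of u in F − uv
  side : Fin k → Bool
  side = ball k

  side-u : side u ≡ true
  side-u = reach⇒ball reach-refl

  side-v : ¬ Reach F∖uv u v → side v ≡ false
  side-v ¬u⇝v with side v in eq
  ... | true  = contradiction (reach-sym F∖uv-sym (ball⇒reach eq)) ¬u⇝v
  ... | false = refl

  side-≡ : ∀ {x y} → Reach F∖uv x y → side x ≡ side y
  side-≡ x⇝y = bool-ext (λ x∈ → reach⇒ball (reach-trans (reach-sym F∖uv-sym x⇝y) (ball⇒reach x∈)))
                        (λ y∈ → reach⇒ball (reach-trans x⇝y (ball⇒reach y∈)))

  module _ (connected : Connected (adj F)) (¬u⇝v : ¬ Reach F∖uv u v) where

    side-false⇒reach-v : ∀ {z} → side z ≡ false → Reach F∖uv v z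
    side-false⇒reach-v {z} z∉ with reach-from-ends (proj₂ (reachable⇒reach (connected u z))) (inj₁ reach-refl)
    ... | inj₁ u⇝z = contradiction (trans (sym (reach⇒ball (reach-sym F∖uv-sym u⇝z))) z∉) λ ()
    ... | inj₂ v⇝z = v⇝z

    side-≡⇒reach : ∀ x y → side x ≡ side y → Reach F∖uv x y
    side-≡⇒reach x y same with side x in sx | side y in sy
    ... | true  | true  = reach-trans (ball⇒reach sx) (reach-sym F∖uv-sym (ball⇒reach sy))
    ... | false | false = reach-trans (reach-sym F∖uv-sym (side-false⇒reach-v sx)) (side-false⇒reach-v sy)

components-≤ : ∀ {n} {A B : Adj n} {c c′} → (∀ x y → Reachable A x y → Reachable B x y) →
  Components A c → Components B c′ → c′ ≤ c
components-≤ {A = A} {B} A⊆B (f , f-onto , f-reach) (f′ , f′-onto , f′-reach) = Fin.injective⇒≤ {f = g} g-inj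
  where
  rep : Fin _ → Fin _
  rep j = proj₁ (f′-onto j)
  g : Fin _ → Fin _
  g j = f (rep j)
  g-inj : Injective _≡_ _≡_ g
  g-inj {j₁} {j₂} g≡ = begin
    j₁          ≡⟨ proj₂ (f′-onto j₁) ⟨
    f′ (rep j₁) ≡⟨ Equivalence.from (f′-reach _ _) (A⊆B _ _ (Equivalence.to (f-reach _ _) g≡)) ⟩
    f′ (rep j₂) ≡⟨ proj₂ (f′-onto j₂) ⟩
    j₂          ∎
    where open ≡-Reasoning

cutEdge⇒disconnecting : ∀ {k} (F : Graph k) → HasCutEdge F →
  ∃[ u ] ∃[ v ] (adj F u v ≡ true × ¬ Reach (removeEdge (adj F) u v) u v)
cutEdge⇒disconnecting F (u , v , Fuv , c , c′ , comps , comps′ , c<c′) =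
  u , v , Fuv , λ u⇝v → <⇒≱ c<c′ (components-≤ {A = adj F} {B = F∖uv} (lift u⇝v) comps comps′)
  where
  open EdgeRemoval F u v
  lift : Reach F∖uv u v → ∀ x y → Reachable (adj F) x y → Reachable F∖uv x y
  lift u⇝v x y x⇝y = reach⇒reachable (reach-lift u⇝v (proj₂ (reachable⇒reach {A = adj F} x⇝y)))

disconnecting⇒cutEdge : ∀ {k} (F : Graph k) → Connected (adj F) → ∀ {u v} → adj F u v ≡ true →
  ¬ Reach (removeEdge (adj F) u v) u v → HasCutEdge F
disconnecting⇒cutEdge F connected {u} {v} Fuv ¬u⇝v = u , v , Fuv , 1 , 2 , one , two , s≤s (s≤s z≤n)
  where
  open EdgeRemoval F u v
  one : Components (adj F) 1
  one = (λ _ → zero) , (λ { zero → u , refl }) , λ x y → mk⇔ (λ _ → connected x y) (λ _ → refl)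
  label : Bool → Fin 2
  label b = if b then zero else suc zero
  two : Components F∖uv 2
  two = label ∘ side
      , (λ { zero → u , cong label side-u ; (suc zero) → v , cong label (side-v ¬u⇝v) })
      , λ x y → mk⇔ (λ same → reach⇒reachable (side-≡⇒reach connected ¬u⇝v x y (label-injective same)))
                    (λ x⇝y → cong label (side-≡ (reachable⇒reach x⇝y)))
    where
    label-injective : ∀ {a b} → label a ≡ label b → a ≡ b
    label-injective {true}  {true}  _ = refl
    label-injective {false} {false} _ = refl

shortDetours-or-cutEdge : ∀ {k} (F : Graph k) → Connected (adj F) → ShortDetours F (suc k) ⊎ HasCutEdge F
shortDetours-or-cutEdge {k} F connected
  with Fin.any? (λ a → Fin.any? (λ b → (adj F a b Bool.≟ true) ×-dec (EdgeRemoval.side F a b b Bool.≟ false)))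
... | yes (a , b , Fab , b∉) =
  inj₂ (disconnecting⇒cutEdge F connected Fab λ a⇝b → contradiction (trans (sym side-u) (trans (side-≡ a⇝b) b∉)) λ ())
  where open EdgeRemoval F a b
... | no none = inj₁ detour
  where
  detour : ShortDetours F (suc k)
  detour a b Fab with EdgeRemoval.side F a b b in b∈
  ... | false = contradiction (a , b , Fab , b∈) none
  ... | true with EdgeRemoval.ball⇒walk F a b k b b∈
  ...   | s , s≤k , w = s , m≤n⇒m≤1+n s≤k , reverse (EdgeRemoval.F∖uv-sym F a b) w

-- Deciding the existence of regular saturated graphs

Searchable : (X : Set) → (X → X → Set) → Set₁
Searchable X _≈_ = ∀ (P : X → Set) → (∀ {x y} → x ≈ y → P x → P y) → (∀ x → Dec (P x)) → Dec (Σ X P)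

Pointwise : ∀ {X : Set} → (X → X → Set) → ∀ {k} → (Fin k → X) → (Fin k → X) → Set
Pointwise _≈_ f g = ∀ i → f i ≈ g i

search-Fin : ∀ {n} → Searchable (Fin n) _≡_
search-Fin P _ P? = Fin.any? P?

search-Bool : Searchable Bool _≡_
search-Bool P _ P? with P? true | P? false
... | yes Pt | _      = yes (true , Pt)
... | no _   | yes Pf = yes (false , Pf)
... | no ¬Pt | no ¬Pf = no λ { (true , Pt) → ¬Pt Pt ; (false , Pf) → ¬Pf Pf }

search-→ : ∀ k {X : Set} {_≈_ : X → X → Set} → (∀ x → x ≈ x) →
  Searchable X _≈_ → Searchable (Fin k → X) (Pointwise _≈_)
search-→ zero refl≈ search P resp P? with P? (λ ())
... | yes P[] = yes ((λ ()) , P[])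
... | no ¬P[] = no λ { (f , Pf) → ¬P[] (resp (λ ()) Pf) }
search-→ (suc k) {X} {_≈_} refl≈ search P resp P?
  with search (λ x → Σ (Fin k → X) λ g → P (x Vector.∷ g)) resp-head
              (λ x → search-→ k refl≈ search (λ g → P (x Vector.∷ g))
                       (λ g≈ → resp (λ { zero → refl≈ x ; (suc i) → g≈ i })) (λ g → P? (x Vector.∷ g)))
  where
  resp-head : ∀ {x y} → x ≈ y → Σ (Fin k → X) (λ g → P (x Vector.∷ g)) → Σ (Fin k → X) (λ g → P (y Vector.∷ g))
  resp-head x≈y (g , Pxg) = g , resp (λ { zero → x≈y ; (suc i) → refl≈ (g i) }) Pxg
... | yes (x , g , Pxg) = yes (x Vector.∷ g , Pxg)
... | no none = no λ { (f , Pf) →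
  none (f zero , (λ i → f (suc i)) , resp (λ { zero → refl≈ (f zero) ; (suc i) → refl≈ (f (suc i)) }) Pf) }

Minimum : (ℕ → Set) → ℕ → Set
Minimum S j = S j × (∀ j′ → S j′ → j ≤ j′)

least : (S : ℕ → Set) → (∀ j → Dec (S j)) → ∀ e → S e → ∃ (Minimum S)
least S S? = <-rec (λ e → S e → ∃ (Minimum S)) step
  where
  step : ∀ e → (∀ {j} → j < e → S j → ∃ (Minimum S)) → S e → ∃ (Minimum S)
  step e below Se with Fin.any? {n = e} (λ j → S? (toℕ j))
  ... | yes (j , Sj) = below (Fin.toℕ<n j) Sj
  ... | no none = e , Se , λ j′ Sj′ → ≮⇒≥ λ j′<e →
    none (Data.Fin.fromℕ< j′<e , subst S (sym (Fin.toℕ-fromℕ< j′<e)) Sj′)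

SameAdj : ∀ {n} → Adj n → Adj n → Set
SameAdj = Pointwise (Pointwise _≡_)

copy-resp : ∀ {k n} (F : Graph k) {A B : Adj n} → SameAdj A B → Copy F A → Copy F B
copy-resp F A≗B (φ , φ-inj , φ-hom) = φ , φ-inj , λ i j Fij → trans (sym (A≗B _ _)) (φ-hom i j Fij)

IsCopy : ∀ {k n} → Graph k → Adj n → (Fin k → Fin n) → Set
IsCopy F A φ = Injective _≡_ _≡_ φ × (∀ i j → adj F i j ≡ true → A (φ i) (φ j) ≡ true)

isCopy-resp : ∀ {k n} (F : Graph k) (A : Adj n) {φ ψ} → Pointwise _≡_ φ ψ → IsCopy F A φ → IsCopy F A ψ
isCopy-resp F A φ≗ψ (φ-inj , φ-hom) = (λ {x} {y} ψ≡ → φ-inj (trans (φ≗ψ x) (trans ψ≡ (sym (φ≗ψ y)))))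
                                    , λ i j Fij → subst₂ (λ p q → A p q ≡ true) (φ≗ψ i) (φ≗ψ j) (φ-hom i j Fij)

isCopy? : ∀ {k n} (F : Graph k) (A : Adj n) φ → Dec (IsCopy F A φ)
isCopy? F A φ = injective? ×-dec (Fin.all? λ i → Fin.all? λ j → (adj F i j Bool.≟ true) →-dec (A (φ i) (φ j) Bool.≟ true))
  where
  injective? : Dec (Injective _≡_ _≡_ φ)
  injective? with Fin.all? (λ x → Fin.all? (λ y → (φ x ≟ φ y) →-dec (x ≟ y)))
  ... | yes inj = yes λ {x} {y} → inj x y
  ... | no ¬inj = no λ inj → ¬inj (λ x y → inj)

copy? : ∀ {k n} (F : Graph k) (A : Adj n) → Dec (Copy F A)
copy? {k} F A = search-→ k (λ _ → refl) search-Fin (IsCopy F A) (isCopy-resp F A) (isCopy? F A)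

regular? : ∀ {n} (G : Graph n) → Dec (Regular G)
regular? {zero}  G = yes (0 , λ ())
regular? {suc n} G with Fin.all? (λ i → degree G i Data.Nat.≟ degree G zero)
... | yes same = yes (degree G zero , same)
... | no ¬same = no λ { (d , deg≡d) → ¬same (λ i → trans (deg≡d i) (sym (deg≡d zero))) }

saturated? : ∀ {k n} (F : Graph k) (G : Graph n) → Dec (Saturated F G)
saturated? F G = ¬? (copy? F (adj G)) ×-dec
  Fin.all? λ u → Fin.all? λ v → ¬? (u ≟ v) →-dec ((adj G u v Bool.≟ false) →-dec copy? F (addEdge (adj G) u v))

RegularSaturated : ∀ {k n} → Graph k → ℕ → Graph n → Set
RegularSaturated F e G = Regular G × Saturated F G × edges G ≡ e

regularSaturated-resp : ∀ {k n} (F : Graph k) {e} (G G′ : Graph n) → SameAdj (adj G) (adj G′) →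
  RegularSaturated F e G → RegularSaturated F e G′
regularSaturated-resp {n = n} F G G′ G≗G′ ((d , deg≡d) , (no-copy , saturated) , edges≡e) =
  (d , λ i → trans (sym (count-cong n (G≗G′ i))) (deg≡d i)) ,
  ((λ copy → no-copy (copy-resp F (λ i j → sym (G≗G′ i j)) copy)) ,
   (λ u v u≢v Guv → copy-resp F {addEdge (adj G) u v} (λ i j → cong (_∨ joins u v i j) (G≗G′ i j))
                                 (saturated u v u≢v (trans (G≗G′ u v) Guv)))) ,
  trans (sym (sum-cong n (λ i → count-cong n (λ j → cong (_∧ _) (G≗G′ i j))))) edges≡e

isRegularSaturated? : ∀ {k n} (F : Graph k) e (G : Graph n) → Dec (RegularSaturated F e G)
isRegularSaturated? F e G = regular? G ×-dec saturated? F G ×-dec (edges G Data.Nat.≟ e)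

graph : ∀ {n} (A : Adj n) → SymAdj A → (∀ i → A i i ≡ false) → Graph n
graph A A-sym A-irrefl = record { adj = A ; sym = A-sym ; irrefl = A-irrefl }

regularSaturated? : ∀ {k} (F : Graph k) n e → Dec (Σ (Graph n) (RegularSaturated F e))
regularSaturated? F n e with search-→ n (λ _ _ → refl) (search-→ n (λ _ → refl) search-Bool) IsGood isGood-resp isGood?
  where
  IsGood : Adj n → Set
  IsGood A = Σ (SymAdj A) λ A-sym → Σ (∀ i → A i i ≡ false) λ A-irrefl → RegularSaturated F e (graph A A-sym A-irrefl)
  isGood-resp : ∀ {A B} → SameAdj A B → IsGood A → IsGood B
  isGood-resp {A} {B} A≗B (A-sym , A-irrefl , good) =
    B-sym , B-irrefl , regularSaturated-resp F (graph A A-sym A-irrefl) (graph B B-sym B-irrefl) A≗B good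
    where
    B-sym : SymAdj B
    B-sym i j = trans (sym (A≗B i j)) (trans (A-sym i j) (A≗B j i))
    B-irrefl : ∀ i → B i i ≡ false
    B-irrefl i = trans (sym (A≗B i i)) (A-irrefl i)
  isGood? : ∀ A → Dec (IsGood A)
  isGood? A with Fin.all? (λ i → Fin.all? (λ j → A i j Bool.≟ A j i)) | Fin.all? (λ i → A i i Bool.≟ false)
  ... | no ¬sym | _          = no λ { (A-sym , _) → ¬sym A-sym }
  ... | yes _   | no ¬irrefl = no λ { (_ , A-irrefl , _) → ¬irrefl A-irrefl }
  ... | yes A-sym | yes A-irrefl with isRegularSaturated? F e (graph A A-sym A-irrefl)
  ...   | yes good = yes (A-sym , A-irrefl , good)
  ...   | no ¬good = no λ { (A-sym′ , A-irrefl′ , good) →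
    ¬good (regularSaturated-resp F (graph A A-sym′ A-irrefl′) (graph A A-sym A-irrefl) (λ _ _ → refl) good) }
... | yes (A , A-sym , A-irrefl , good) = yes (graph A A-sym A-irrefl , good)
... | no none = no λ { (G , good) → none (adj G , Graph.sym G , irrefl G , good) }

rsat-exists : ∀ {k n} (F : Graph k) (G : Graph n) → Regular G → Saturated F G → ∃[ e ] (IsRsat F n e × e ≤ edges G)
rsat-exists {n = n} F G reg sat with least _ (regularSaturated? F n) (edges G) (G , reg , sat , refl)
... | e , witness , minimal =
  e , (witness , λ H reg′ sat′ → minimal (edges H) (H , reg′ , sat′ , refl)) , minimal (edges G) (G , reg , sat , refl)

-- Disjoint unions of cliques

-- punchOut made total; the value at j = i is junk
punchOutOr : ∀ {s} → Fin s → Fin (suc s) → Fin (suc s) → Fin s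
punchOutOr d i j with i ≟ j
... | yes _  = d
... | no i≢j = punchOut i≢j

punchOutOr-injective : ∀ {s} (d : Fin s) i {j j′} → ¬ i ≡ j → ¬ i ≡ j′ →
  punchOutOr d i j ≡ punchOutOr d i j′ → j ≡ j′
punchOutOr-injective d i {j} {j′} i≢j i≢j′ eq with i ≟ j | i ≟ j′
... | yes i≡j | _        = contradiction i≡j i≢j
... | no _    | yes i≡j′ = contradiction i≡j′ i≢j′
... | no _    | no _     = Fin.punchOut-injective i≢j i≢j′ eq

transpose-sends : ∀ {n} (i j : Fin n) → transpose i j i ≡ j
transpose-sends i j rewrite dec-true (i ≟ i) refl = refl

transpose-injective : ∀ {n} (i j : Fin n) {a b} → transpose i j a ≡ transpose i j b → a ≡ b
transpose-injective i j {a} {b} eq =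
  trans (sym (transpose-inverse j i)) (trans (cong (transpose j i) eq) (transpose-inverse j i))

module Cliques (q s : ℕ) where

  block : Fin (q * s) → Fin q
  block = quotient s

  slot : Fin (q * s) → Fin s
  slot = remainder {q} s

  block-combine : ∀ b r → block (combine b r) ≡ b
  block-combine b r = cong proj₁ (Fin.remQuot-combine {q} {s} b r)

  combine-block-slot : ∀ i → combine (block i) (slot i) ≡ i
  combine-block-slot i = Fin.combine-remQuot {q} s i

  block-slot-injective : ∀ {i j} → block i ≡ block j → slot i ≡ slot j → i ≡ j
  block-slot-injective {i} {j} same-block same-slot =
    trans (sym (combine-block-slot i)) (trans (cong₂ combine same-block same-slot) (combine-block-slot j))

  cliques : Graph (q * s)
  cliques = record
    { adj    = λ i j → (block i == block j) ∧ not (i == j)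
    ; sym    = λ i j → cong₂ (λ a b → a ∧ not b) (==-comm (block i) (block j)) (==-comm i j)
    ; irrefl = λ i → trans (cong (λ b → (block i == block i) ∧ not b) (==-refl i)) (Bool.∧-zeroʳ _)
    }

  cliques-adj : ∀ {i j} → block i ≡ block j → ¬ i ≡ j → adj cliques i j ≡ true
  cliques-adj same-block i≢j rewrite ≡⇒== same-block | ≢⇒== i≢j = refl

  cliques-adj-block : ∀ {i j} → adj cliques i j ≡ true → block i ≡ block j
  cliques-adj-block Gij = ==⇒≡ (Bool.∧-conicalˡ _ _ Gij)

  degree-cliques : ∀ i → degree cliques i + 1 ≡ s
  degree-cliques i = begin
    degree cliques i + 1
      ≡⟨ cong (degree cliques i +_) (sym (count-== (q * s) i)) ⟩
    degree cliques i + countFin (q * s) (i ==_)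
      ≡⟨ sum-+ (q * s) _ _ ⟨
    sumFin (q * s) (λ j → indicator (adj cliques i j) + indicator (i == j))
      ≡⟨ sum-cong (q * s) (λ j → indicator-∧-not _ (i == j) (λ i==j → ≡⇒== (cong block (==⇒≡ i==j)))) ⟩
    countFin (q * s) (λ j → block i == block j)
      ≡⟨ sum-combine q s _ ⟩
    sumFin q (λ b → sumFin s (λ r → indicator (block i == block (combine b r))))
      ≡⟨ sum-cong q (λ b → sum-cong s (λ r → cong (λ c → indicator (block i == c)) (block-combine b r))) ⟩
    sumFin q (λ b → sumFin s (λ _ → indicator (block i == b)))
      ≡⟨ sum-cong q (λ b → sum-const s _) ⟩
    sumFin q (λ b → indicator (block i == b) * s)
      ≡⟨ sum-*ʳ q _ s ⟩
    countFin q (block i ==_) * s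
      ≡⟨ cong (_* s) (count-== q (block i)) ⟩
    1 * s
      ≡⟨ *-identityˡ s ⟩
    s ∎
    where open ≡-Reasoning

  cliques-regular : ∀ i → degree cliques i ≡ s ∸ 1
  cliques-regular i = trans (sym (m+n∸n≡m (degree cliques i) 1)) (cong (_∸ 1) (degree-cliques i))

  walk-block : ∀ {x y t} → Walk′ (adj cliques) x y t → block x ≡ block y
  walk-block []           = refl
  walk-block (Gxy ∷ rest) = trans (cliques-adj-block Gxy) (walk-block rest)

  cliques-F-free : (F : Graph (suc s)) → Connected (adj F) → ¬ Copy F (adj cliques)
  cliques-F-free F connected (φ , φ-inj , φ-hom) = contradiction (Fin.injective⇒≤ slot∘φ-inj) (<-irrefl refl)
    where
    same-block : ∀ z → block (φ zero) ≡ block (φ z)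
    same-block z = walk-block (map φ φ-hom (proj₂ (reachable⇒reach (connected zero z))))
    slot∘φ-inj : Injective _≡_ _≡_ (slot ∘ φ)
    slot∘φ-inj {a} {b} eq = φ-inj (block-slot-injective (trans (sym (same-block a)) (same-block b)) eq)

  -- embeds F − w into block b, sending a to slot r
  place : Fin q → Fin s → (w a : Fin (suc s)) → Fin (suc s) → Fin (q * s)
  place b r w a z = combine b (transpose (punchOutOr r w a) r (punchOutOr r w z))

  place-anchor : ∀ b r w a → place b r w a a ≡ combine b r
  place-anchor b r w a = cong (combine b) (transpose-sends (punchOutOr r w a) r)

  block-place : ∀ b r w a z → block (place b r w a z) ≡ b
  block-place b r w a z = block-combine b _

  place-injective : ∀ b r w a {z z′} → ¬ w ≡ z → ¬ w ≡ z′ → place b r w a z ≡ place b r w a z′ → z ≡ z′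
  place-injective b r w a w≢z w≢z′ eq =
    punchOutOr-injective r w w≢z w≢z′ (transpose-injective _ r (proj₂ (Fin.combine-injective b _ b _ eq)))

  module _ (F : Graph (suc s)) (connected : Connected (adj F)) {u v : Fin (suc s)} (Fuv : adj F u v ≡ true)
           (¬u⇝v : ¬ Reach (removeEdge (adj F) u v) u v) where
    open EdgeRemoval F u v

    module _ {x y : Fin (q * s)} (different-blocks : ¬ block x ≡ block y) where

      φ : Fin (suc s) → Fin (q * s)
      φ z = if side z then place (block x) (slot x) v u z else place (block y) (slot y) u v z

      φ-u : φ u ≡ x
      φ-u rewrite side-u = trans (place-anchor (block x) (slot x) v u) (combine-block-slot x)

      φ-v : φ v ≡ y
      φ-v rewrite side-v ¬u⇝v = trans (place-anchor (block y) (slot y) u v) (combine-block-slot y)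

      block-φ : ∀ z → block (φ z) ≡ (if side z then block x else block y)
      block-φ z = trans (Bool.if-float block (side z))
        (cong₂ (λ p q → if side z then p else q) (block-place (block x) (slot x) v u z) (block-place (block y) (slot y) u v z))

      φ-same-side : ∀ {z z′} → φ z ≡ φ z′ → side z ≡ side z′
      φ-same-side {z} {z′} eq = blocks-separate (side z) (side z′) (trans (sym (block-φ z)) (trans (cong block eq) (block-φ z′)))
        where
        blocks-separate : ∀ a b → (if a then block x else block y) ≡ (if b then block x else block y) → a ≡ b
        blocks-separate true  true  _ = refl
        blocks-separate false false _ = refl
        blocks-separate true  false e = contradiction e different-blocks
        blocks-separate false true  e = contradiction (sym e) different-blocks

      φ-x : ∀ {z} → side z ≡ true → φ z ≡ place (block x) (slot x) v u z
      φ-x {z} z∈ = cong (λ b → if b then place (block x) (slot x) v u z else place (block y) (slot y) u v z) z∈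

      φ-y : ∀ {z} → side z ≡ false → φ z ≡ place (block y) (slot y) u v z
      φ-y {z} z∉ = cong (λ b → if b then place (block x) (slot x) v u z else place (block y) (slot y) u v z) z∉

      φ-injective : Injective _≡_ _≡_ φ
      φ-injective {z} {z′} eq = on-sides (side z) (side z′) refl refl
        where
        v-side : ∀ {z} → side z ≡ true → ¬ v ≡ z
        v-side z∈ refl = contradiction (trans (sym z∈) (side-v ¬u⇝v)) λ ()
        u-side : ∀ {z} → side z ≡ false → ¬ u ≡ z
        u-side z∉ refl = contradiction (trans (sym side-u) z∉) λ ()
        on-sides : ∀ a b → side z ≡ a → side z′ ≡ b → z ≡ z′
        on-sides true  true  sz sz′ = place-injective _ _ v u (v-side sz) (v-side sz′) (trans (sym (φ-x sz)) (trans eq (φ-x sz′)))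
        on-sides false false sz sz′ = place-injective _ _ u v (u-side sz) (u-side sz′) (trans (sym (φ-y sz)) (trans eq (φ-y sz′)))
        on-sides true  false sz sz′ = contradiction (trans (sym sz) (trans (φ-same-side eq) sz′)) λ ()
        on-sides false true  sz sz′ = contradiction (trans (sym sz) (trans (φ-same-side eq) sz′)) λ ()

      φ-hom : ∀ i j → adj F i j ≡ true → addEdge (adj cliques) x y (φ i) (φ j) ≡ true
      φ-hom i j Fij with F∖uv i j in kept
      ... | true = addEdge-old (adj cliques) (cliques-adj same-block λ φi≡φj → irrefl-≢ (φ-injective φi≡φj))
        where
        same-block : block (φ i) ≡ block (φ j)
        same-block = trans (block-φ i)
          (trans (cong (λ b → if b then block x else block y) (side-≡ (reach-edge kept))) (sym (block-φ j)))
        irrefl-≢ : ¬ i ≡ j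
        irrefl-≢ refl = contradiction (trans (sym Fij) (irrefl F i)) λ ()
      ... | false with removeEdge-removes (adj F) Fij kept
      ...   | inj₁ (refl , refl) = addEdge-new (adj cliques) (inj₁ (φ-u , φ-v))
      ...   | inj₂ (refl , refl) = addEdge-new (adj cliques) (inj₂ (φ-v , φ-u))

    cliques-saturated : Saturated F cliques
    cliques-saturated = cliques-F-free F connected , λ x y x≢y ¬Gxy →
      φ (different-blocks x≢y ¬Gxy) , φ-injective (different-blocks x≢y ¬Gxy) , φ-hom (different-blocks x≢y ¬Gxy)
      where
      different-blocks : ∀ {x y} → ¬ x ≡ y → adj cliques x y ≡ false → ¬ block x ≡ block y
      different-blocks x≢y ¬Gxy same = contradiction (trans (sym (cliques-adj same x≢y)) ¬Gxy) λ ()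

  cliques-edges : edges cliques ≤ s * (q * s)
  cliques-edges = begin
    edges cliques                 ≤⟨ m≤m+n _ _ ⟩
    edges cliques + edges cliques ≡⟨ regular-handshake cliques cliques-regular ⟨
    q * s * (s ∸ 1)               ≤⟨ *-monoʳ-≤ (q * s) (m∸n≤m s 1) ⟩
    q * s * s                     ≡⟨ *-comm (q * s) s ⟩
    s * (q * s)                   ∎
    where open ≤-Reasoning

-- Part (iii)

rsatOmega⇒¬liminfLinear : ∀ {k} (F : Graph k) L → RsatOmega F L → ¬ LiminfLinear F
rsatOmega⇒¬liminfLinear F L (a , b , 1≤a , _ , N , lower) (C , often-linear)
  with often-linear (N + suc (b * C ^ L))
... | n , N+K≤n , e , rsat , e≤Cn = contradiction n≤K (<⇒≱ K<n)
  where
  K : ℕ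
  K = b * C ^ L
  K<n : K < n
  K<n = ≤-trans (m≤n+m (suc K) N) N+K≤n
  instance
    n^L≢0 : NonZero (n ^ L)
    n^L≢0 = m^n≢0 n L {{>-nonZero (≤-trans (s≤s z≤n) K<n)}}
  n≤K : n ≤ K
  n≤K = *-cancelʳ-≤ n K (n ^ L) (begin
    n * n ^ L         ≤⟨ m≤n*m _ a {{>-nonZero 1≤a}} ⟩
    a * n ^ suc L     ≤⟨ lower n (≤-trans (m≤m+n N (suc K)) N+K≤n) e rsat ⟩
    b * e ^ L         ≤⟨ *-monoʳ-≤ b (^-monoˡ-≤ L e≤Cn) ⟩
    b * (C * n) ^ L   ≡⟨ cong (b *_) (^-distribʳ-* C n L) ⟩
    b * (C ^ L * n ^ L) ≡⟨ *-assoc b (C ^ L) (n ^ L) ⟨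
    K * n ^ L         ∎)
    where open ≤-Reasoning

liminfLinear⇒cutEdge : ∀ {k} (F : Graph k) → Connected (adj F) → LiminfLinear F → HasCutEdge F
liminfLinear⇒cutEdge {k} F connected linear with shortDetours-or-cutEdge F connected
... | inj₁ detour = contradiction linear (rsatOmega⇒¬liminfLinear F (suc k) (shortDetours⇒rsatOmega F (suc k) (s≤s z≤n) detour))
... | inj₂ cut    = cut

cutEdge⇒liminfLinear : ∀ {k} (F : Graph k) → Connected (adj F) → HasCutEdge F → LiminfLinear F
cutEdge⇒liminfLinear {suc zero} F _ (zero , zero , F00 , _) = contradiction (trans (sym F00) (irrefl F zero)) λ ()
cutEdge⇒liminfLinear {suc s@(suc _)} F connected cut with cutEdge⇒disconnecting F cut
... | u , v , Fuv , ¬u⇝v = s , λ N →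
  let open Cliques N s
      e , rsat , e≤edges = rsat-exists F cliques (s ∸ 1 , cliques-regular) (cliques-saturated F connected Fuv ¬u⇝v)
  in N * s , m≤m*n N s , e , rsat , ≤-trans e≤edges cliques-edges

proposition1p2 : (k : ℕ) (F : Graph k) →
    ((m : ℕ) → 1 ≤ m → (∀ u v → adj F u v ≡ true → EdgeInCycleAtMost F u v (suc m)) → RsatOmega F m)
    × ((r : ℕ) → 1 ≤ r → (∀ u v → adj F u v ≡ true → DiamAtMost (removeEdge (adj F) u v) r) → RsatOmega F r)
    × (Connected (adj F) → (LiminfLinear F ⇔ HasCutEdge F))
proposition1p2 k F =
  (λ m 1≤m cycles → shortDetours⇒rsatOmega F m 1≤m (cycles⇒shortDetours F m cycles)) ,
  (λ r 1≤r diameter → shortDetours⇒rsatOmega F r 1≤r (diameter⇒shortDetours F r diameter)) ,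
  (λ connected → mk⇔ (liminfLinear⇒cutEdge F connected) (cutEdge⇒liminfLinear F connected))
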